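{- Let $p_1,\dots,p_n$ be distinct primes and $N=p_1^{\alpha_1}\cdots p_n^{\alpha_n}$ with $\alpha_1\ge \alpha_2\ge\cdots\ge \alpha_u>\alpha_{u+1}=\cdots =\alpha_n\ge 2$ (where $u=0$ if all $\alpha_i$ are equal). Then $R(\{p_{u+1}\},N),\ldots,R(\{p_n\},N)$ are all the maximal $N$-sets with the minimum size; that is, a set of positive divisors of $N$ is a maximal $N$-set with the minimum size if and only if it equals $R(\{p_v\},N)=\{d: d\mid N,\ p_v\mid d\}$ for some $u+1\le v\le n$.
   Context: A set $\mathcal D$ of positive divisors of $N$ is an $N$-set if no two elements of $\mathcal D$ are coprime; an $N$-set is maximal if no additional positive divisor of $N$ can be included in it while keeping the $N$-set property. "Maximal $N$-set with the minimum size" means a maximal $N$-set whose cardinality is the minimum of the cardinalities of all maximal $N$-sets. For a set $\mathcal T$ of positive divisors of $N$, $R(\mathcal T,N)$ denotes the set of all positive divisors of $N$ that are divisible by at least one element of $\mathcal T$. -}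

module Defs where

open import Data.Nat using (ℕ; zero; suc; _*_; _^_; _<_)
open import Data.Nat.Divisibility using (_∣_)
open import Data.Nat.Coprimality using (Coprime)
open import Data.Fin using (Fin; zero; suc)
open import Data.List using (List; _∷_; length)
open import Data.List.Membership.Propositional using (_∈_; _∉_)
open import Data.List.Relation.Unary.Unique.Propositional using (Unique)
open import Data.Product using (_×_)
open import Data.Nat using (_≤_)
open import Relation.Nullary using (¬_)

prodFin : (n : ℕ) → (Fin n → ℕ) → ℕ
prodFin zero    f = 1
prodFin (suc n) f = f zero * prodFin n (λ i → f (suc i))

primePowerProduct : (n : ℕ) → (Fin n → ℕ) → (Fin n → ℕ) → ℕ
primePowerProduct n p α = prodFin n (λ i → p i ^ α i)

PosDivisor : ℕ → ℕ → Set
PosDivisor N d = 0 < d × d ∣ N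

-- A finite set of positive divisors of N, represented as a duplicate-free list
-- (so its cardinality is the length of the list).
DivisorSet : ℕ → List ℕ → Set
DivisorSet N D = Unique D × (∀ {d} → d ∈ D → PosDivisor N d)

-- N-set: a set of positive divisors of N, no two elements (a = b allowed) coprime
IsNSet : ℕ → List ℕ → Set
IsNSet N D = DivisorSet N D × (∀ {a b} → a ∈ D → b ∈ D → ¬ Coprime a b)

IsMaximalNSet : ℕ → List ℕ → Set
IsMaximalNSet N D = IsNSet N D × (∀ d → PosDivisor N d → d ∉ D → ¬ IsNSet N (d ∷ D))

IsMinMaximalNSet : ℕ → List ℕ → Set
IsMinMaximalNSet N D = IsMaximalNSet N D × (∀ E → IsMaximalNSet N E → length D ≤ length E)

EqualsR : ℕ → ℕ → List ℕ → Set
EqualsR N q D = ∀ d → (d ∈ D → PosDivisor N d × q ∣ d) × (PosDivisor N d × q ∣ d → d ∈ D)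

module Submission where

-- Divisors of N are identified with exponent vectors x ≤ α (unique factorisation).
-- (1) If α_b is minimal, R({p_b}, N) injects into every maximal N-set E: members of E
--     stay fixed and an outsider ⟦ x ⟧ ∉ E goes to ⟦ x − x_b ⟧, subtracting cyclically
--     mod α_i + 1 in every coordinate.  Hence R({p_u}, N) has minimum size, which with
--     its maximality gives the backward direction.
-- (2) For a minimum-size maximal D the injection R({p_u}, N) → D is therefore onto.  From
--     surjectivity we get, for every colouring τ ≤ α of the primes with τ_u = 0, a member
--     of D all of whose prime factors have one colour; applying this to three-colourings
--     in a descent shows that D contains a prime p_w, so D = R({p_w}, N).  Surjectivity
--     once more shows α_w is minimal, i.e. w ≥ u.

open import Defs
open import Data.Nat using (ℕ; zero; suc; _+_; _*_; _∸_; _^_; _<_; _≤_; z≤n; s≤s; _≟_; _≤?_; _<?_;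
  >-nonZero; nonTrivial⇒n>1)
open import Data.Nat.Properties
open import Data.Nat.Divisibility
open import Data.Nat.Coprimality using (Coprime; coprime?; coprime-divisor; gcd≡1⇒coprime)
import Data.Nat.Coprimality as Coprimality
open import Data.Nat.GCD using (gcd[m,n]∣m; gcd[m,n]∣n)
open import Data.Nat.Primality using (Prime; euclidsLemma; prime⇒irreducible; prime⇒nonTrivial; prime⇒nonZero)
open import Data.Nat.Induction using (<-wellFounded)
open import Data.Fin using (Fin; zero; suc; toℕ; fromℕ<) renaming (_≤_ to _≤ᶠ_)
import Data.Fin.Properties as Fin
open import Data.Vec.Functional using (updateAt)
open import Data.Vec.Functional.Properties using (updateAt-updates; updateAt-minimal)
open import Data.List using (List; []; _∷_; length; map; filter; upTo)
open import Data.List.Properties using (length-map)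
open import Data.List.Membership.Propositional using (_∈_; _∉_; find; lose)
open import Data.List.Membership.Propositional.Properties using (∈-map⁻; ∈-filter⁺; ∈-filter⁻; ∈-upTo⁺)
open import Data.List.Membership.DecPropositional _≟_ using (_∈?_)
open import Data.List.Relation.Unary.Any using (here; there; any?)
import Data.List.Relation.Unary.All as All
open import Data.List.Relation.Unary.Unique.Propositional using (Unique; []; _∷_)
import Data.List.Relation.Unary.Unique.Propositional.Properties as UniqueProperties
open import Data.Product using (_×_; _,_; proj₁; proj₂; Σ; ∃-syntax)
open import Data.Sum using (_⊎_; inj₁; inj₂)
open import Data.Empty using (⊥; ⊥-elim)
open import Function using (_∘_)
open import Function.Bundles using (_⇔_; mk⇔)
open import Induction.WellFounded using (Acc; acc)
open import Relation.Nullary using (¬_; Dec; yes; no)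
open import Relation.Nullary.Decidable using (_×-dec_)
open import Relation.Binary.PropositionalEquality using (_≡_; _≢_; refl; sym; trans; cong; cong₂; subst)


prime>1 : ∀ {q} → Prime q → 1 < q
prime>1 {q} q-prime = nonTrivial⇒n>1 q {{prime⇒nonTrivial q-prime}}

prime∤1 : ∀ {q} → Prime q → ¬ q ∣ 1
prime∤1 q-prime q∣1 = <-irrefl (sym (∣1⇒≡1 q∣1)) (prime>1 q-prime)

prime∣prime⇒≡ : ∀ {q r} → Prime q → Prime r → q ∣ r → q ≡ r
prime∣prime⇒≡ q-prime r-prime q∣r with prime⇒irreducible r-prime q∣r
... | inj₁ refl = ⊥-elim (prime∤1 q-prime ∣-refl)
... | inj₂ q≡r  = q≡r

prime∣^⇒∣ : ∀ {q r} k → Prime q → q ∣ r ^ k → 1 ≤ k × q ∣ r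
prime∣^⇒∣ zero q-prime q∣1 = ⊥-elim (prime∤1 q-prime q∣1)
prime∣^⇒∣ {r = r} (suc k) q-prime q∣r^1+k with euclidsLemma r (r ^ k) q-prime q∣r^1+k
... | inj₁ q∣r   = s≤s z≤n , q∣r
... | inj₂ q∣r^k = s≤s z≤n , proj₂ (prime∣^⇒∣ k q-prime q∣r^k)

∤prime⇒coprime : ∀ {q d} → Prime q → ¬ q ∣ d → Coprime d q
∤prime⇒coprime q-prime q∤d {i} (i∣d , i∣q) with prime⇒irreducible q-prime i∣q
... | inj₁ i≡1 = i≡1
... | inj₂ refl = ⊥-elim (q∤d i∣d)

coprime⇒¬prime∣both : ∀ {q a b} → Prime q → Coprime a b → q ∣ a → ¬ q ∣ b
coprime⇒¬prime∣both q-prime cop q∣a q∣b = <-irrefl (sym (cop (q∣a , q∣b))) (prime>1 q-prime)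

pow∣pow : ∀ m {a b} → a ≤ b → m ^ a ∣ m ^ b
pow∣pow m {a} {b} a≤b = subst (λ c → m ^ a ∣ m ^ c) (m+[n∸m]≡n a≤b)
  (subst (m ^ a ∣_) (sym (^-distribˡ-+-* m a (b ∸ a))) (m∣m*n (m ^ (b ∸ a))))

prime-power-cancel : ∀ {q} a b {A B} → Prime q → ¬ q ∣ A → ¬ q ∣ B →
  q ^ a * A ≡ q ^ b * B → a ≡ b × A ≡ B
prime-power-cancel zero zero {A} {B} _ _ _ e = refl , trans (sym (*-identityˡ A)) (trans e (*-identityˡ B))
prime-power-cancel {q} zero (suc b) {A} {B} _ q∤A _ e =
  ⊥-elim (q∤A (subst (q ∣_) (trans (sym e) (*-identityˡ A)) (∣m⇒∣m*n B (m∣m*n (q ^ b)))))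
prime-power-cancel {q} (suc a) zero {A} {B} _ _ q∤B e =
  ⊥-elim (q∤B (subst (q ∣_) (trans e (*-identityˡ B)) (∣m⇒∣m*n A (m∣m*n (q ^ a)))))
prime-power-cancel {q} (suc a) (suc b) {A} {B} q-prime q∤A q∤B e
  with prime-power-cancel a b q-prime q∤A q∤B
         (*-cancelˡ-≡ (q ^ a * A) (q ^ b * B) q {{prime⇒nonZero q-prime}}
           (trans (sym (*-assoc q (q ^ a) A)) (trans e (*-assoc q (q ^ b) B))))
... | refl , A≡B = refl , A≡B

split-prime-power : ∀ {q M} k d → Prime q → ¬ q ∣ M → d ∣ q ^ k * M →
  Σ ℕ λ j → j ≤ k × Σ ℕ λ d' → d ≡ q ^ j * d' × d' ∣ M
split-prime-power {q} {M} zero d _ _ d∣M =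
  0 , z≤n , d , sym (*-identityˡ d) , subst (d ∣_) (*-identityˡ M) d∣M
split-prime-power {q} {M} (suc k) d q-prime q∤M d∣ with q ∣? d
... | yes (divides c refl)
  with split-prime-power k c q-prime q∤M
         (*-cancelʳ-∣ q {{prime⇒nonZero q-prime}}
           (subst (c * q ∣_) (trans (*-assoc q (q ^ k) M) (*-comm q (q ^ k * M))) d∣))
...   | j , j≤k , d' , refl , d'∣M =
  suc j , s≤s j≤k , d' , trans (*-comm (q ^ j * d') q) (sym (*-assoc q (q ^ j) d')) , d'∣M
split-prime-power {q} {M} (suc k) d q-prime q∤M d∣ | no q∤d
  with split-prime-power k d q-prime q∤M
         (coprime-divisor (∤prime⇒coprime q-prime q∤d) (subst (d ∣_) (*-assoc q (q ^ k) M) d∣))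
... | j , j≤k , rest = j , m≤n⇒m≤1+n j≤k , rest

AllPrime : (n : ℕ) → (Fin n → ℕ) → Set
AllPrime n p = ∀ i → Prime (p i)

Distinct : (n : ℕ) → (Fin n → ℕ) → Set
Distinct n p = ∀ i j → p i ≡ p j → i ≡ j

distinct-tail : ∀ {n p} → Distinct (suc n) p → Distinct n (p ∘ suc)
distinct-tail distinct i j e = Fin.suc-injective (distinct (suc i) (suc j) e)

pp-prime∣ : ∀ n p x {q} → AllPrime n p → Prime q → q ∣ primePowerProduct n p x →
  Σ (Fin n) λ i → q ≡ p i × 1 ≤ x i
pp-prime∣ zero p x prime q-prime q∣1 = ⊥-elim (prime∤1 q-prime q∣1)
pp-prime∣ (suc n) p x prime q-prime q∣ with euclidsLemma (p zero ^ x zero) _ q-prime q∣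
... | inj₁ q∣head with prime∣^⇒∣ (x zero) q-prime q∣head
...   | 1≤x₀ , q∣p₀ = zero , prime∣prime⇒≡ q-prime (prime zero) q∣p₀ , 1≤x₀
pp-prime∣ (suc n) p x prime q-prime q∣ | inj₂ q∣tail
  with pp-prime∣ n (p ∘ suc) (x ∘ suc) (prime ∘ suc) q-prime q∣tail
... | i , e , 1≤xᵢ = suc i , e , 1≤xᵢ

pp-dvd : ∀ n p x i → 1 ≤ x i → p i ∣ primePowerProduct n p x
pp-dvd (suc n) p x zero 1≤x₀ = ∣m⇒∣m*n _ (∣-trans (m∣m*n 1) (pow∣pow (p zero) 1≤x₀))
pp-dvd (suc n) p x (suc i) 1≤xᵢ = ∣n⇒∣m*n (p zero ^ x zero) (pp-dvd n (p ∘ suc) (x ∘ suc) i 1≤xᵢ)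

pp-pos : ∀ n p x → AllPrime n p → 0 < primePowerProduct n p x
pp-pos zero p x prime = s≤s z≤n
pp-pos (suc n) p x prime =
  *-mono-< {0} {p zero ^ x zero} {0} (m^n>0 (p zero) {{prime⇒nonZero (prime zero)}} (x zero))
    (pp-pos n (p ∘ suc) (x ∘ suc) (prime ∘ suc))

pp-mono : ∀ n p x y → (∀ i → x i ≤ y i) → primePowerProduct n p x ∣ primePowerProduct n p y
pp-mono zero p x y x≤y = ∣-refl
pp-mono (suc n) p x y x≤y =
  *-pres-∣ (pow∣pow (p zero) (x≤y zero)) (pp-mono n (p ∘ suc) (x ∘ suc) (y ∘ suc) (x≤y ∘ suc))

pp-ext : ∀ n p x y → (∀ i → x i ≡ y i) → primePowerProduct n p x ≡ primePowerProduct n p y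
pp-ext zero p x y x≗y = refl
pp-ext (suc n) p x y x≗y =
  cong₂ (λ a b → p zero ^ a * b) (x≗y zero) (pp-ext n (p ∘ suc) (x ∘ suc) (y ∘ suc) (x≗y ∘ suc))

pp-zero : ∀ n p → primePowerProduct n p (λ _ → 0) ≡ 1
pp-zero zero p = refl
pp-zero (suc n) p = trans (*-identityˡ _) (pp-zero n (p ∘ suc))

unit : ∀ {n} → Fin n → Fin n → ℕ
unit v = updateAt (λ _ → 0) v (λ _ → 1)

pp-unit : ∀ n p v → primePowerProduct n p (unit v) ≡ p v
pp-unit (suc n) p zero = trans (cong₂ _*_ (*-identityʳ (p zero)) (pp-zero n (p ∘ suc))) (*-identityʳ (p zero))
pp-unit (suc n) p (suc v) = trans (*-identityˡ _) (pp-unit n (p ∘ suc) v)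

head∤tail : ∀ n p y → AllPrime (suc n) p → Distinct (suc n) p →
  ¬ p zero ∣ primePowerProduct n (p ∘ suc) y
head∤tail n p y prime distinct p₀∣ with pp-prime∣ n (p ∘ suc) y (prime ∘ suc) (prime zero) p₀∣
... | i , e , _ with distinct zero (suc i) e
... | ()

pp-injective : ∀ n p x y → AllPrime n p → Distinct n p →
  primePowerProduct n p x ≡ primePowerProduct n p y → ∀ i → x i ≡ y i
pp-injective (suc n) p x y prime distinct e i
  with prime-power-cancel (x zero) (y zero) (prime zero)
         (head∤tail n p (x ∘ suc) prime distinct) (head∤tail n p (y ∘ suc) prime distinct) e
pp-injective (suc n) p x y prime distinct e zero | x₀≡y₀ , _ = x₀≡y₀
pp-injective (suc n) p x y prime distinct e (suc i) | _ , tails≡ =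
  pp-injective n (p ∘ suc) (x ∘ suc) (y ∘ suc) (prime ∘ suc) (distinct-tail distinct) tails≡ i

pp-divisor : ∀ n p a d → AllPrime n p → Distinct n p → d ∣ primePowerProduct n p a →
  Σ (Fin n → ℕ) λ x → (∀ i → x i ≤ a i) × d ≡ primePowerProduct n p x
pp-divisor zero p a d prime distinct d∣1 = (λ ()) , (λ ()) , ∣1⇒≡1 d∣1
pp-divisor (suc n) p a d prime distinct d∣
  with split-prime-power (a zero) d (prime zero) (head∤tail n p (a ∘ suc) prime distinct) d∣
... | j , j≤a₀ , d' , refl , d'∣
  with pp-divisor n (p ∘ suc) (a ∘ suc) d' (prime ∘ suc) (distinct-tail distinct) d'∣
... | x , x≤a , refl = cons , cons≤a , refl
  where
  cons : Fin (suc n) → ℕ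
  cons zero = j
  cons (suc i) = x i
  cons≤a : ∀ i → cons i ≤ a i
  cons≤a zero = j≤a₀
  cons≤a (suc i) = x≤a i

-- subMod a t A  is  (a − t) mod (A + 1)  for a, t ≤ A: cyclic subtraction in ℤ/(A+1).
subMod : ℕ → ℕ → ℕ → ℕ
subMod a t A with t ≤? a
... | yes _ = a ∸ t
... | no  _ = suc (A + a) ∸ t

subMod-cases : ∀ a t A → t ≤ A →
  (t ≤ a × subMod a t A + t ≡ a) ⊎ (a < t × subMod a t A + t ≡ suc (A + a))
subMod-cases a t A t≤A with t ≤? a
... | yes t≤a = inj₁ (t≤a , m∸n+n≡m t≤a)
... | no  t≰a = inj₂ (≰⇒> t≰a , m∸n+n≡m (≤-trans t≤A (≤-trans (m≤m+n A a) (n≤1+n _))))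

subMod-≤ : ∀ a t A → t ≤ A → a ≤ A → subMod a t A ≤ A
subMod-≤ a t A t≤A a≤A with subMod-cases a t A t≤A
... | inj₁ (_ , e) = ≤-trans (m≤m+n _ t) (subst (_≤ A) (sym e) a≤A)
... | inj₂ (a<t , e) = +-cancelʳ-≤ t _ A
  (subst (_≤ A + t) (sym e) (subst (_≤ A + t) (+-suc A a) (+-monoʳ-≤ A a<t)))

subMod-self : ∀ t A → subMod t t A ≡ 0
subMod-self t A with t ≤? t
... | yes _ = n∸n≡0 t
... | no t≰t = ⊥-elim (t≰t ≤-refl)

subMod-suc : ∀ t A → subMod (suc t) t A ≡ 1
subMod-suc t A with t ≤? suc t
... | yes _ = m+n∸n≡m 1 t
... | no t≰1+t = ⊥-elim (t≰1+t (n≤1+n t))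

≤⇒≢wrapped : ∀ {a a' A} → a ≤ A → a ≢ suc (A + a')
≤⇒≢wrapped {a' = a'} {A} a≤A refl = 1+n≰n (≤-trans (s≤s (m≤m+n A a')) a≤A)

subMod-injˡ : ∀ a a' t A → t ≤ A → a ≤ A → a' ≤ A → subMod a t A ≡ subMod a' t A → a ≡ a'
subMod-injˡ a a' t A t≤A a≤A a'≤A e with subMod-cases a t A t≤A | subMod-cases a' t A t≤A
... | inj₁ (_ , e₁) | inj₁ (_ , e₂) = trans (sym e₁) (trans (cong (_+ t) e) e₂)
... | inj₂ (_ , e₁) | inj₂ (_ , e₂) =
  +-cancelˡ-≡ A a a' (suc-injective (trans (sym e₁) (trans (cong (_+ t) e) e₂)))
... | inj₁ (_ , e₁) | inj₂ (_ , e₂) = ⊥-elim (≤⇒≢wrapped a≤A (trans (sym e₁) (trans (cong (_+ t) e) e₂)))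
... | inj₂ (_ , e₁) | inj₁ (_ , e₂) =
  ⊥-elim (≤⇒≢wrapped a'≤A (trans (sym e₂) (trans (cong (_+ t) (sym e)) e₁)))

-- Without wrap-around the difference s is at most a, so adding t' ≤ A cannot reach A + a + 1.
no-wrap : ∀ {s t t' a A} → s + t ≡ a → s + t' ≡ suc (A + a) → t' ≤ A → ⊥
no-wrap {s} {t} {t'} {a} {A} e₁ e₂ t'≤A = 1+n≰n (subst (_≤ A + a) e₂
  (≤-trans (+-mono-≤ (subst (s ≤_) e₁ (m≤m+n s t)) t'≤A) (≤-reflexive (+-comm a A))))

subMod-injʳ : ∀ a t t' A → t ≤ A → t' ≤ A → subMod a t A ≡ subMod a t' A → t ≡ t'
subMod-injʳ a t t' A t≤A t'≤A e with subMod-cases a t A t≤A | subMod-cases a t' A t'≤A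
... | inj₁ (_ , e₁) | inj₁ (_ , e₂) = +-cancelˡ-≡ _ t t' (trans e₁ (trans (sym e₂) (cong (_+ t') (sym e))))
... | inj₂ (_ , e₁) | inj₂ (_ , e₂) = +-cancelˡ-≡ _ t t' (trans e₁ (trans (sym e₂) (cong (_+ t') (sym e))))
... | inj₁ (_ , e₁) | inj₂ (_ , e₂) = ⊥-elim (no-wrap e₁ (trans (cong (_+ t') e) e₂) t'≤A)
... | inj₂ (_ , e₁) | inj₁ (_ , e₂) = ⊥-elim (no-wrap e₂ (trans (cong (_+ t) (sym e)) e₁) t≤A)

delete : ∀ {x : ℕ} ys → x ∈ ys →
  Σ (List ℕ) λ ys' → length ys ≡ suc (length ys') × (∀ {w} → w ∈ ys → w ≢ x → w ∈ ys')
delete (y ∷ ys) (here refl) = ys , refl , λ { (here refl) w≢x → ⊥-elim (w≢x refl) ; (there w∈) _ → w∈ }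
delete (y ∷ ys) (there x∈) with delete ys x∈
... | ys' , len , keep = y ∷ ys' , cong suc len ,
  λ { (here refl) _ → here refl ; (there w∈) w≢x → there (keep w∈ w≢x) }

unique-⊆⇒length≤ : ∀ zs ys → Unique zs → (∀ {w} → w ∈ zs → w ∈ ys) → length zs ≤ length ys
unique-⊆⇒length≤ [] ys _ _ = z≤n
unique-⊆⇒length≤ (z ∷ zs) ys (z∉zs ∷ zs!) zs⊆ys with delete ys (zs⊆ys (here refl))
... | ys' , len , keep = subst (suc (length zs) ≤_) (sym len)
  (s≤s (unique-⊆⇒length≤ zs ys' zs! λ w∈ → keep (zs⊆ys (there w∈)) λ w≡z → All.lookup z∉zs w∈ (sym w≡z)))

InjectiveOn : (ℕ → ℕ) → List ℕ → Set
InjectiveOn f xs = ∀ {a b} → a ∈ xs → b ∈ xs → f a ≡ f b → a ≡ b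

MapsInto : (ℕ → ℕ) → List ℕ → List ℕ → Set
MapsInto f xs ys = ∀ {a} → a ∈ xs → f a ∈ ys

map-unique : ∀ f xs → Unique xs → InjectiveOn f xs → Unique (map f xs)
map-unique f [] _ _ = []
map-unique f (x ∷ xs) (x∉xs ∷ xs!) inj =
  All.tabulate fx∉ ∷ map-unique f xs xs! (λ a∈ b∈ → inj (there a∈) (there b∈))
  where
  fx∉ : ∀ {y} → y ∈ map f xs → f x ≢ y
  fx∉ y∈ refl with ∈-map⁻ f y∈
  ... | a , a∈ , e = All.lookup x∉xs a∈ (inj (here refl) (there a∈) e)

image⊆ : ∀ f xs ys → MapsInto f xs ys → ∀ {w} → w ∈ map f xs → w ∈ ys
image⊆ f xs ys into w∈ with ∈-map⁻ f w∈
... | a , a∈ , refl = into a∈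

injection⇒length≤ : ∀ f xs ys → Unique xs → InjectiveOn f xs → MapsInto f xs ys → length xs ≤ length ys
injection⇒length≤ f xs ys xs! inj into = subst (_≤ length ys) (length-map f xs)
  (unique-⊆⇒length≤ (map f xs) ys (map-unique f xs xs! inj) (image⊆ f xs ys into))

injection⇒onto : ∀ f xs ys → Unique xs → InjectiveOn f xs → MapsInto f xs ys →
  length ys ≤ length xs → ∀ {y} → y ∈ ys → Σ ℕ λ x → x ∈ xs × f x ≡ y
injection⇒onto f xs ys xs! inj into |ys|≤|xs| {y} y∈ with any? (λ x → f x ≟ y) xs
... | yes hit = find hit
... | no miss = ⊥-elim (<⇒≱ (subst (λ m → suc m ≤ length ys) (length-map f xs)
        (unique-⊆⇒length≤ (y ∷ map f xs) ys (All.tabulate y∉ ∷ map-unique f xs xs! inj) y∷image⊆))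
        |ys|≤|xs|)
  where
  y∉ : ∀ {w} → w ∈ map f xs → y ≢ w
  y∉ w∈ refl with ∈-map⁻ f w∈
  ... | a , a∈ , e = miss (lose a∈ (sym e))
  y∷image⊆ : ∀ {w} → w ∈ y ∷ map f xs → w ∈ ys
  y∷image⊆ (here refl) = y∈
  y∷image⊆ (there w∈) = image⊆ f xs ys into w∈

transpose : ℕ → ℕ → ℕ
transpose c k with k ≟ c | k ≟ 0
... | yes _ | _     = 0
... | no  _ | yes _ = c
... | no  _ | no  _ = k

transpose-self : ∀ c → transpose c c ≡ 0
transpose-self c with c ≟ c
... | yes _ = refl
... | no c≢c = ⊥-elim (c≢c refl)

transpose-≤ : ∀ {m} c k → c ≤ m → k ≤ m → transpose c k ≤ m
transpose-≤ c k c≤m k≤m with k ≟ c | k ≟ 0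
... | yes _ | _     = z≤n
... | no  _ | yes _ = c≤m
... | no  _ | no  _ = k≤m

transpose-injective : ∀ c k k' → transpose c k ≡ transpose c k' → k ≡ k'
transpose-injective c k k' e with k ≟ c | k ≟ 0 | k' ≟ c | k' ≟ 0
... | yes refl | _        | yes refl | _        = refl
... | yes refl | _        | no _     | yes refl = sym e
... | yes refl | _        | no _     | no k'≢0  = ⊥-elim (k'≢0 (sym e))
... | no _     | yes refl | yes refl | _        = sym e
... | no _     | yes refl | no _     | yes refl = refl
... | no _     | yes refl | no k'≢c  | no _     = ⊥-elim (k'≢c (sym e))
... | no _     | no k≢0   | yes refl | _        = ⊥-elim (k≢0 e)
... | no k≢c   | no _     | no _     | yes refl = ⊥-elim (k≢c e)
... | no _     | no _     | no _     | no _     = e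

label : ∀ {n} → (Fin n → ℕ) → Fin n → Fin n → ℕ
label x s i with i Fin.≟ s | x i ≟ 0
... | yes _ | _     = 0
... | no  _ | yes _ = 2
... | no  _ | no  _ = 1

label-≤2 : ∀ {n} (x : Fin n → ℕ) s i → label x s i ≤ 2
label-≤2 x s i with i Fin.≟ s | x i ≟ 0
... | yes _ | _     = z≤n
... | no  _ | yes _ = s≤s (s≤s z≤n)
... | no  _ | no  _ = s≤s z≤n

label≡0⇒ : ∀ {n} (x : Fin n → ℕ) s i → label x s i ≡ 0 → i ≡ s
label≡0⇒ x s i e with i Fin.≟ s | x i ≟ 0
label≡0⇒ x s i e  | yes i≡s | _     = i≡s
label≡0⇒ x s i () | no  _   | yes _
label≡0⇒ x s i () | no  _   | no  _

label≡1⇒ : ∀ {n} (x : Fin n → ℕ) s i → label x s i ≡ 1 → i ≢ s × x i ≢ 0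
label≡1⇒ x s i e with i Fin.≟ s | x i ≟ 0
label≡1⇒ x s i () | yes _   | _
label≡1⇒ x s i () | no  _   | yes _
label≡1⇒ x s i e  | no  i≢s | no xᵢ≢0 = i≢s , xᵢ≢0

label≡2⇒ : ∀ {n} (x : Fin n → ℕ) s i → label x s i ≡ 2 → x i ≡ 0
label≡2⇒ x s i e with i Fin.≟ s | x i ≟ 0
label≡2⇒ x s i () | yes _ | _
label≡2⇒ x s i e  | no  _ | yes xᵢ≡0 = xᵢ≡0
label≡2⇒ x s i () | no  _ | no  _

module DivisorsOf (n : ℕ) (p : Fin n → ℕ) (α : Fin n → ℕ)
                  (prime : AllPrime n p) (distinct : Distinct n p) where

  N : ℕ
  N = primePowerProduct n p α

  ⟦_⟧ : (Fin n → ℕ) → ℕ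
  ⟦ x ⟧ = primePowerProduct n p x

  -- The exponent vector of a divisor of N (irrelevant for non-divisors).
  exponents : ℕ → Fin n → ℕ
  exponents d with d ∣? N
  ... | yes d∣N = proj₁ (pp-divisor n p α d prime distinct d∣N)
  ... | no  _   = λ _ → 0

  exponents-spec : ∀ {d} → d ∣ N → (∀ i → exponents d i ≤ α i) × d ≡ ⟦ exponents d ⟧
  exponents-spec {d} d∣N with d ∣? N
  ... | yes d∣N' = proj₂ (pp-divisor n p α d prime distinct d∣N')
  ... | no  d∤N  = ⊥-elim (d∤N d∣N)

  prime∣⟦⟧⇒1≤ : ∀ x j → p j ∣ ⟦ x ⟧ → 1 ≤ x j
  prime∣⟦⟧⇒1≤ x j pⱼ∣ with pp-prime∣ n p x prime (prime j) pⱼ∣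
  ... | i , pⱼ≡pᵢ , 1≤xᵢ with distinct j i pⱼ≡pᵢ
  ... | refl = 1≤xᵢ

  prime∤⟦⟧⇒≡0 : ∀ x j → ¬ p j ∣ ⟦ x ⟧ → x j ≡ 0
  prime∤⟦⟧⇒≡0 x j pⱼ∤ with x j ≟ 0
  ... | yes xⱼ≡0 = xⱼ≡0
  ... | no  xⱼ≢0 = ⊥-elim (pⱼ∤ (pp-dvd n p x j (n≢0⇒n>0 xⱼ≢0)))

  ∣N⇒pos : ∀ {d} → d ∣ N → 0 < d
  ∣N⇒pos {zero} 0∣N = ⊥-elim (<-irrefl (sym (0∣⇒≡0 0∣N)) (pp-pos n p α prime))
  ∣N⇒pos {suc d} _ = s≤s z≤n

  ∣N⇒posDivisor : ∀ {d} → d ∣ N → PosDivisor N d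
  ∣N⇒posDivisor d∣N = ∣N⇒pos d∣N , d∣N

  prime-posDivisor : ∀ i → 1 ≤ α i → PosDivisor N (p i)
  prime-posDivisor i 1≤αᵢ = ∣N⇒posDivisor (pp-dvd n p α i 1≤αᵢ)

  nonunit⇒prime∣ : ∀ {d} → d ∣ N → d ≢ 1 → Σ (Fin n) λ j → p j ∣ d
  nonunit⇒prime∣ {d} d∣N d≢1 with Fin.any? (λ j → 1 ≤? exponents d j)
  ... | yes (j , 1≤xⱼ) = j , subst (p j ∣_) (sym (proj₂ (exponents-spec d∣N))) (pp-dvd n p (exponents d) j 1≤xⱼ)
  ... | no none = ⊥-elim (d≢1 (trans (proj₂ (exponents-spec d∣N))
          (trans (pp-ext n p _ _ (λ j → n≤0⇒n≡0 (≮⇒≥ (λ 0<xⱼ → none (j , 0<xⱼ))))) (pp-zero n p))))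

  drop : (Fin n → ℕ) → Fin n → Fin n → ℕ
  drop x s = updateAt x s (λ _ → 0)

  drop-∣ : ∀ x s → ⟦ drop x s ⟧ ∣ ⟦ x ⟧
  drop-∣ x s = pp-mono n p (drop x s) x drop-≤
    where
    drop-≤ : ∀ i → drop x s i ≤ x i
    drop-≤ i with i Fin.≟ s
    ... | yes refl = ≤-trans (≤-reflexive (updateAt-updates s x)) z≤n
    ... | no  i≢s  = ≤-reflexive (updateAt-minimal i s x i≢s)

  drop-∤ : ∀ x s → ¬ p s ∣ ⟦ drop x s ⟧
  drop-∤ x s pₛ∣ = <-irrefl (sym (updateAt-updates s x)) (prime∣⟦⟧⇒1≤ (drop x s) s pₛ∣)

  drop-keeps : ∀ x s j → j ≢ s → 1 ≤ x j → p j ∣ ⟦ drop x s ⟧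
  drop-keeps x s j j≢s 1≤xⱼ =
    pp-dvd n p (drop x s) j (subst (1 ≤_) (sym (updateAt-minimal j s x j≢s)) 1≤xⱼ)

  module Maximal (E : List ℕ) (E-max : IsMaximalNSet N E) where

    E-unique : Unique E
    E-unique = proj₁ (proj₁ (proj₁ E-max))

    E-divisor : ∀ {d} → d ∈ E → PosDivisor N d
    E-divisor = proj₂ (proj₁ (proj₁ E-max))

    E-noncoprime : ∀ {a b} → a ∈ E → b ∈ E → ¬ Coprime a b
    E-noncoprime = proj₂ (proj₁ E-max)

    members-share : ∀ {e e'} → e ∈ E → e' ∈ E → Σ (Fin n) λ j → p j ∣ e × p j ∣ e'
    members-share {e} {e'} e∈ e'∈
      with nonunit⇒prime∣ (∣-trans (gcd[m,n]∣m e e') (proj₂ (E-divisor e∈)))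
             (λ gcd≡1 → E-noncoprime e∈ e'∈ (gcd≡1⇒coprime gcd≡1))
    ... | j , pⱼ∣gcd = j , ∣-trans pⱼ∣gcd (gcd[m,n]∣m e e') , ∣-trans pⱼ∣gcd (gcd[m,n]∣n e e')

    member-prime : ∀ {e} → e ∈ E → Σ (Fin n) λ j → p j ∣ e
    member-prime e∈ with members-share e∈ e∈
    ... | j , pⱼ∣e , _ = j , pⱼ∣e

    outsider-coprime : ∀ {d} → PosDivisor N d → d ∉ E → d ≢ 1 → Σ ℕ λ e → e ∈ E × Coprime d e
    outsider-coprime {d} d-div d∉ d≢1 with any? (coprime? d) E
    ... | yes some = find some
    ... | no none = ⊥-elim (proj₂ E-max d d-div d∉ d∷E-nset)
      where
      d∷E-nset : IsNSet N (d ∷ E)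
      d∷E-nset = ((All.tabulate (λ e∈ d≡e → d∉ (subst (_∈ E) (sym d≡e) e∈)) ∷ E-unique) ,
                   λ { (here refl) → d-div ; (there e∈) → E-divisor e∈ }) ,
                 λ { (here refl) (here refl) cop → d≢1 (cop (∣-refl , ∣-refl))
                   ; (here refl) (there b∈) cop → none (lose b∈ cop)
                   ; (there a∈) (here refl) cop → none (lose a∈ (Coprimality.sym cop))
                   ; (there a∈) (there b∈) cop → E-noncoprime a∈ b∈ cop }

    member-avoids : ∀ {e c} → e ∈ E → PosDivisor N c → c ∉ E → Σ (Fin n) λ j → p j ∣ e × ¬ p j ∣ c
    member-avoids {c = c} e∈ c-div c∉ with c ≟ 1
    ... | yes refl with member-prime e∈
    ...   | j , pⱼ∣e = j , pⱼ∣e , prime∤1 (prime j)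
    member-avoids e∈ c-div c∉ | no c≢1 with outsider-coprime c-div c∉ c≢1
    ... | e' , e'∈ , cop with members-share e∈ e'∈
    ...   | j , pⱼ∣e , pⱼ∣e' = j , pⱼ∣e , coprime⇒¬prime∣both (prime j) (Coprimality.sym cop) pⱼ∣e'

    absorbs : ∀ {e c} → e ∈ E → PosDivisor N c → (∀ j → p j ∣ e → p j ∣ c) → c ∈ E
    absorbs {c = c} e∈ c-div covers with c ∈? E
    ... | yes c∈ = c∈
    ... | no c∉ with member-avoids e∈ c-div c∉
    ...   | j , pⱼ∣e , pⱼ∤c = ⊥-elim (pⱼ∤c (covers j pⱼ∣e))

    outsiders-miss : ∀ {c d} → PosDivisor N c → c ∉ E → PosDivisor N d → d ∉ E → d ≢ 1 →
      Σ (Fin n) λ j → ¬ p j ∣ c × ¬ p j ∣ d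
    outsiders-miss c-div c∉ d-div d∉ d≢1 with outsider-coprime d-div d∉ d≢1
    ... | e , e∈ , cop with member-avoids e∈ c-div c∉
    ...   | j , pⱼ∣e , pⱼ∤c = j , pⱼ∤c , coprime⇒¬prime∣both (prime j) (Coprimality.sym cop) pⱼ∣e

    prime-member⇒R : ∀ v → p v ∈ E → EqualsR N (p v) E
    prime-member⇒R v pᵥ∈ d = (λ d∈ → E-divisor d∈ , pᵥ∣ d∈) , λ (d-div , pᵥ∣d) →
      absorbs pᵥ∈ d-div λ j pⱼ∣pᵥ → subst (_∣ d) (sym (prime∣prime⇒≡ (prime j) (prime v) pⱼ∣pᵥ)) pᵥ∣d
      where
      pᵥ∣ : d ∈ E → p v ∣ d
      pᵥ∣ d∈ with members-share pᵥ∈ d∈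
      ... | j , pⱼ∣pᵥ , pⱼ∣d = subst (_∣ d) (prime∣prime⇒≡ (prime j) (prime v) pⱼ∣pᵥ) pⱼ∣d

  InR : ℕ → ℕ → Set
  InR q d = PosDivisor N d × q ∣ d

  InR? : ∀ q d → Dec (InR q d)
  InR? q d = ((0 <? d) ×-dec (d ∣? N)) ×-dec (q ∣? d)

  -- R({q}, N) listed explicitly (positive divisors of N are below N + 1).
  R : ℕ → List ℕ
  R q = filter (InR? q) (upTo (suc N))

  R-spec : ∀ q → EqualsR N q (R q)
  R-spec q d = proj₂ ∘ ∈-filter⁻ (InR? q) {xs = upTo (suc N)} ,
    λ inR → ∈-filter⁺ (InR? q) (∈-upTo⁺ (s≤s (∣⇒≤ {{>-nonZero (pp-pos n p α prime)}} (proj₂ (proj₁ inR))))) inR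

  R-divisorSet : ∀ q → DivisorSet N (R q)
  R-divisorSet q = UniqueProperties.filter⁺ (InR? q) (UniqueProperties.upTo⁺ (suc N)) , λ d∈ → proj₁ (proj₁ (R-spec q _) d∈)

  -- Any set equal to R({pᵥ}, N) is a maximal N-set: pᵥ is a common factor, and a
  -- divisor not divisible by pᵥ is coprime to pᵥ, itself a member.
  R-maximal : ∀ v D → 1 ≤ α v → EqualsR N (p v) D → DivisorSet N D → IsMaximalNSet N D
  R-maximal v D 1≤αᵥ D≡R D-div = (D-div , noncoprime) , maximal
    where
    noncoprime : ∀ {a b} → a ∈ D → b ∈ D → ¬ Coprime a b
    noncoprime a∈ b∈ cop = coprime⇒¬prime∣both (prime v) cop (proj₂ (proj₁ (D≡R _) a∈)) (proj₂ (proj₁ (D≡R _) b∈))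
    maximal : ∀ d → PosDivisor N d → d ∉ D → ¬ IsNSet N (d ∷ D)
    maximal d d-div d∉ d∷D-nset with p v ∣? d
    ... | yes pᵥ∣d = d∉ (proj₂ (D≡R d) (d-div , pᵥ∣d))
    ... | no  pᵥ∤d = proj₂ d∷D-nset (here refl) (there (proj₂ (D≡R (p v)) (prime-posDivisor v 1≤αᵥ , ∣-refl)))
                       (∤prime⇒coprime (prime v) pᵥ∤d)

  module ShiftInjection (b : Fin n) (b-min : ∀ i → α b ≤ α i)
                        (E : List ℕ) (E-max : IsMaximalNSet N E) where
    open Maximal E E-max

    shift : (Fin n → ℕ) → Fin n → ℕ
    shift x i = subMod (x i) (x b) (α i)

    ψ : ℕ → ℕ
    ψ d with d ∈? E
    ... | yes _ = d
    ... | no  _ = ⟦ shift (exponents d) ⟧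

    ψ-cases : ∀ d → (d ∈ E × ψ d ≡ d) ⊎ (d ∉ E × ψ d ≡ ⟦ shift (exponents d) ⟧)
    ψ-cases d with d ∈? E
    ... | yes d∈ = inj₁ (d∈ , refl)
    ... | no  d∉ = inj₂ (d∉ , refl)

    module Shifted {d} (d∈R : InR (p b) d) where
      x : Fin n → ℕ
      x = exponents d

      x≤α : ∀ i → x i ≤ α i
      x≤α = proj₁ (exponents-spec (proj₂ (proj₁ d∈R)))

      d≡⟦x⟧ : d ≡ ⟦ x ⟧
      d≡⟦x⟧ = proj₂ (exponents-spec (proj₂ (proj₁ d∈R)))

      t : ℕ
      t = x b

      1≤t : 1 ≤ t
      1≤t = prime∣⟦⟧⇒1≤ x b (subst (p b ∣_) d≡⟦x⟧ (proj₂ d∈R))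

      t≤α : ∀ i → t ≤ α i
      t≤α i = ≤-trans (x≤α b) (b-min i)

      d≢1 : d ≢ 1
      d≢1 refl = prime∤1 (prime b) (proj₂ d∈R)

      image-div : PosDivisor N ⟦ shift x ⟧
      image-div = ∣N⇒posDivisor (pp-mono n p (shift x) α λ i → subMod-≤ (x i) t (α i) (t≤α i) (x≤α i))

      p_b∤image : ¬ p b ∣ ⟦ shift x ⟧
      p_b∤image p_b∣ = <-irrefl (sym (subMod-self t (α b))) (prime∣⟦⟧⇒1≤ (shift x) b p_b∣)

      missing-prime : ∀ j → ¬ p j ∣ d → shift x j ≡ subMod 0 t (α j)
      missing-prime j pⱼ∤d =
        cong (λ a → subMod a t (α j)) (prime∤⟦⟧⇒≡0 x j (subst (λ c → ¬ p j ∣ c) d≡⟦x⟧ pⱼ∤d))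

    open Shifted

    -- ψ d ∈ E: if ⟦ shift x ⟧ were an outsider too, a prime p_j missing from both would
    -- give x_j = 0 and  0 − t ≡ 0 , i.e. t = 0.
    ψ-into : ∀ {d} → InR (p b) d → ψ d ∈ E
    ψ-into {d} d∈R with ψ-cases d
    ... | inj₁ (d∈ , ψd≡d) = subst (_∈ E) (sym ψd≡d) d∈
    ... | inj₂ (d∉ , ψd≡) with ⟦ shift (x d∈R) ⟧ ∈? E
    ...   | yes c∈ = subst (_∈ E) (sym ψd≡) c∈
    ...   | no  c∉ with outsiders-miss (image-div d∈R) c∉ (proj₁ d∈R) d∉ (d≢1 d∈R)
    ...     | j , pⱼ∤c , pⱼ∤d = ⊥-elim (<-irrefl t≡0 (1≤t d∈R))
      where
      t≡0 : 0 ≡ t d∈R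
      t≡0 = subMod-injˡ 0 (t d∈R) (t d∈R) (α j) (t≤α d∈R j) z≤n (t≤α d∈R j)
        (trans (sym (missing-prime d∈R j pⱼ∤d)) (trans (prime∤⟦⟧⇒≡0 (shift (x d∈R)) j pⱼ∤c)
          (sym (subMod-self (t d∈R) (α j)))))

    -- ψ is injective: images of outsiders avoid p_b, unlike members of R({p_b}, N); two
    -- outsiders miss a common prime, which pins down t, and then x by injectivity of subMod.
    ψ-injective : ∀ {d d'} → InR (p b) d → InR (p b) d' → ψ d ≡ ψ d' → d ≡ d'
    ψ-injective {d} {d'} d∈R d'∈R e with ψ-cases d | ψ-cases d'
    ... | inj₁ (_ , e₁) | inj₁ (_ , e₂) = trans (sym e₁) (trans e e₂)
    ... | inj₁ (_ , e₁) | inj₂ (_ , e₂) =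
      ⊥-elim (p_b∤image d'∈R (subst (p b ∣_) (trans (sym e₁) (trans e e₂)) (proj₂ d∈R)))
    ... | inj₂ (_ , e₁) | inj₁ (_ , e₂) =
      ⊥-elim (p_b∤image d∈R (subst (p b ∣_) (trans (sym e₂) (trans (sym e) e₁)) (proj₂ d'∈R)))
    ... | inj₂ (d∉ , e₁) | inj₂ (d'∉ , e₂)
      with outsiders-miss (proj₁ d∈R) d∉ (proj₁ d'∈R) d'∉ (d≢1 d'∈R)
    ...   | j , pⱼ∤d , pⱼ∤d' = trans (d≡⟦x⟧ d∈R) (trans (pp-ext n p _ _ x≗x') (sym (d≡⟦x⟧ d'∈R)))
      where
      shifts≗ : ∀ i → shift (x d∈R) i ≡ shift (x d'∈R) i
      shifts≗ = pp-injective n p _ _ prime distinct (trans (sym e₁) (trans e e₂))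
      -- at a prime missing from both, the shifted exponents are  −t  and  −t' , so t = t'
      t≡t' : t d∈R ≡ t d'∈R
      t≡t' = subMod-injʳ 0 (t d∈R) (t d'∈R) (α j) (t≤α d∈R j) (t≤α d'∈R j)
        (trans (sym (missing-prime d∈R j pⱼ∤d)) (trans (shifts≗ j) (missing-prime d'∈R j pⱼ∤d')))
      x≗x' : ∀ i → x d∈R i ≡ x d'∈R i
      x≗x' i = subMod-injˡ _ _ (t d∈R) (α i) (t≤α d∈R i) (x≤α d∈R i) (x≤α d'∈R i)
        (subst (λ s → subMod (x d∈R i) (t d∈R) (α i) ≡ subMod (x d'∈R i) s (α i)) (sym t≡t') (shifts≗ i))

  R-minimum : ∀ b → (∀ i → α b ≤ α i) → ∀ D E → EqualsR N (p b) D → DivisorSet N D →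
    IsMaximalNSet N E → length D ≤ length E
  R-minimum b b-min D E D≡R D-div E-max = injection⇒length≤ ψ D E (proj₁ D-div)
    (λ a∈ b∈ → ψ-injective (proj₁ (D≡R _) a∈) (proj₁ (D≡R _) b∈)) (λ a∈ → ψ-into (proj₁ (D≡R _) a∈))
    where open ShiftInjection b b-min E E-max

  module MinimumSize (u : Fin n) (u-min : ∀ i → α u ≤ α i) (2≤αᵤ : 2 ≤ α u)
                     (D : List ℕ) (D-min : IsMinMaximalNSet N D) where

    D-max : IsMaximalNSet N D
    D-max = proj₁ D-min

    open Maximal D D-max
    open ShiftInjection u u-min D D-max
    open Shifted

    2≤α : ∀ i → 2 ≤ α i
    2≤α i = ≤-trans 2≤αᵤ (u-min i)

    1≤α : ∀ i → 1 ≤ α i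
    1≤α i = ≤-trans (s≤s z≤n) (2≤α i)

    pᵤ∈R : InR (p u) (p u)
    pᵤ∈R = prime-posDivisor u (1≤α u) , ∣-refl

    R-max : IsMaximalNSet N (R (p u))
    R-max = R-maximal u (R (p u)) (1≤α u) (R-spec (p u)) (R-divisorSet (p u))

    ∈R⇒InR : ∀ {d} → d ∈ R (p u) → InR (p u) d
    ∈R⇒InR d∈ = proj₁ (R-spec (p u) _) d∈

    -- By minimality |D| ≤ |R({p_u}, N)|, so the injection ψ : R({p_u}, N) → D is onto.
    ψ-onto : ∀ {y} → y ∈ D → Σ ℕ λ d → InR (p u) d × ψ d ≡ y
    ψ-onto y∈ with injection⇒onto ψ (R (p u)) D (proj₁ (R-divisorSet (p u)))
                     (λ a∈ b∈ → ψ-injective (∈R⇒InR a∈) (∈R⇒InR b∈)) (λ a∈ → ψ-into (∈R⇒InR a∈))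
                     (proj₂ D-min (R (p u)) R-max) y∈
    ... | d , d∈R , ψd≡y = d , ∈R⇒InR d∈R , ψd≡y

    Monochromatic : (Fin n → ℕ) → ℕ → Set
    Monochromatic τ e = ∀ {j j'} → p j ∣ e → p j' ∣ e → τ j ≡ τ j'

    constant⇒monochromatic : ∀ τ e k → (∀ j → p j ∣ e → τ j ≡ k) → Monochromatic τ e
    constant⇒monochromatic τ e k const {j} {j'} pⱼ∣e pⱼ'∣e = trans (const j pⱼ∣e) (sym (const j' pⱼ'∣e))

    -- Look at c = ⟦ −τ mod (α + 1) ⟧.  If c ∉ D, c is 1 or coprime to a member, whose
    -- primes then have colour 0.  If c ∈ D, c = ψ d for an outsider d = ⟦ x ⟧ with
    -- x − t ≡ −τ; a member coprime to d sees only exponents x_j = 0, i.e. colour τ_j = t.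
    module Colouring (τ : Fin n → ℕ) (τ≤α : ∀ i → τ i ≤ α i) (τᵤ≡0 : τ u ≡ 0) where

      y : Fin n → ℕ
      y i = subMod 0 (τ i) (α i)

      c : ℕ
      c = ⟦ y ⟧

      c-div : PosDivisor N c
      c-div = ∣N⇒posDivisor (pp-mono n p y α λ i → subMod-≤ 0 (τ i) (α i) (τ≤α i) z≤n)

      missing⇒colour0 : ∀ j → ¬ p j ∣ c → τ j ≡ 0
      missing⇒colour0 j pⱼ∤c = subMod-injʳ 0 (τ j) 0 (α j) (τ≤α j) z≤n
        (trans (prime∤⟦⟧⇒≡0 y j pⱼ∤c) (sym (subMod-self 0 (α j))))

      pᵤ∤c : ¬ p u ∣ c
      pᵤ∤c pᵤ∣c = <-irrefl (sym (trans (cong (λ k → subMod 0 k (α u)) τᵤ≡0) (subMod-self 0 (α u))))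
        (prime∣⟦⟧⇒1≤ y u pᵤ∣c)

      outside : c ∉ D → Σ ℕ λ e → e ∈ D × Monochromatic τ e
      outside c∉ with c ≟ 1
      ... | yes c≡1 = ψ (p u) , ψ-into pᵤ∈R , constant⇒monochromatic τ _ 0
        λ j _ → missing⇒colour0 j (subst (λ m → ¬ p j ∣ m) (sym c≡1) (prime∤1 (prime j)))
      ... | no c≢1 with outsider-coprime c-div c∉ c≢1
      ...   | e , e∈ , cop = e , e∈ , constant⇒monochromatic τ e 0
        λ j pⱼ∣e → missing⇒colour0 j (coprime⇒¬prime∣both (prime j) (Coprimality.sym cop) pⱼ∣e)

      inside : c ∈ D → Σ ℕ λ e → e ∈ D × Monochromatic τ e
      inside c∈ with ψ-onto c∈
      ... | d , d∈R , ψd≡c with ψ-cases d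
      ...   | inj₁ (_ , ψd≡d) = ⊥-elim (pᵤ∤c (subst (p u ∣_) (trans (sym ψd≡d) ψd≡c) (proj₂ d∈R)))
      ...   | inj₂ (d∉ , ψd≡) with outsider-coprime (proj₁ d∈R) d∉ (d≢1 d∈R)
      ...     | e , e∈ , cop = e , e∈ , constant⇒monochromatic τ e (t d∈R) colour-t
        where
        shift≗y : ∀ i → shift (x d∈R) i ≡ y i
        shift≗y = pp-injective n p _ _ prime distinct (trans (sym ψd≡) ψd≡c)
        colour-t : ∀ j → p j ∣ e → τ j ≡ t d∈R
        colour-t j pⱼ∣e = subMod-injʳ 0 (τ j) (t d∈R) (α j) (τ≤α j) (t≤α d∈R j)
          (trans (sym (shift≗y j))
            (missing-prime d∈R j (coprime⇒¬prime∣both (prime j) (Coprimality.sym cop) pⱼ∣e)))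

      monochromatic-member : Σ ℕ λ e → e ∈ D × Monochromatic τ e
      monochromatic-member with c ∈? D
      ... | yes c∈ = inside c∈
      ... | no  c∉ = outside c∉

    open Colouring using (monochromatic-member)

    -- Descent: from a member e we reach a prime member or a smaller member.  Pick a prime
    -- p_s ∣ e and colour s by 0, the other primes of e by 1, the remaining primes by 2,
    -- transposing colours so that u gets colour 0.  A monochromatic member e' then has
    -- only the prime p_s (so p_s ∈ D), or only primes of e other than p_s (so e with p_s
    -- deleted is a smaller member); it cannot avoid e, with which it shares a prime.
    prime-member-below : ∀ e → Acc _<_ e → e ∈ D → Σ (Fin n) λ w → p w ∈ D
    prime-member-below e (acc smaller) e∈ = conclude (monochromatic-member τ τ≤α τᵤ≡0)
      where
      s : Fin n
      s = proj₁ (member-prime e∈)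

      a : Fin n → ℕ
      a = exponents e

      e≡⟦a⟧ : e ≡ ⟦ a ⟧
      e≡⟦a⟧ = proj₂ (exponents-spec (proj₂ (E-divisor e∈)))

      ℓ : Fin n → ℕ
      ℓ = label a s

      τ : Fin n → ℕ
      τ i = transpose (ℓ u) (ℓ i)

      τ≤α : ∀ i → τ i ≤ α i
      τ≤α i = ≤-trans (transpose-≤ (ℓ u) (ℓ i) (label-≤2 a s u) (label-≤2 a s i)) (2≤α i)

      τᵤ≡0 : τ u ≡ 0
      τᵤ≡0 = transpose-self (ℓ u)

      e⁻ : ℕ
      e⁻ = ⟦ drop a s ⟧

      e⁻∣e : e⁻ ∣ e
      e⁻∣e = subst (e⁻ ∣_) (sym e≡⟦a⟧) (drop-∣ a s)

      e⁻<e : e⁻ < e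
      e⁻<e = ≤∧≢⇒< (∣⇒≤ {{>-nonZero (proj₁ (E-divisor e∈))}} e⁻∣e)
        λ e⁻≡e → drop-∤ a s (subst (p s ∣_) (sym e⁻≡e) (proj₂ (member-prime e∈)))

      conclude : Σ ℕ (λ e' → e' ∈ D × Monochromatic τ e') → Σ (Fin n) λ w → p w ∈ D
      conclude (e' , e'∈ , mono) = by-colour (ℓ j₁) refl (label-≤2 a s j₁)
        where
        j₁ : Fin n
        j₁ = proj₁ (member-prime e'∈)

        -- the colours of e' differ only by the transposition, so its labels agree
        label-of : ∀ {j} → p j ∣ e' → ∀ {k} → ℓ j₁ ≡ k → ℓ j ≡ k
        label-of pⱼ∣e' ℓⱼ₁≡k = trans (transpose-injective (ℓ u) _ _ (mono pⱼ∣e' (proj₂ (member-prime e'∈)))) ℓⱼ₁≡k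

        by-colour : ∀ k → ℓ j₁ ≡ k → k ≤ 2 → Σ (Fin n) λ w → p w ∈ D
        by-colour 0 ℓⱼ₁≡0 _ = s , absorbs e'∈ (prime-posDivisor s (1≤α s)) λ j pⱼ∣e' →
          subst (λ i → p i ∣ p s) (sym (label≡0⇒ a s j (label-of pⱼ∣e' ℓⱼ₁≡0))) ∣-refl
        by-colour 1 ℓⱼ₁≡1 _ = prime-member-below e⁻ (smaller e⁻<e)
          (absorbs e'∈ (∣N⇒posDivisor (∣-trans e⁻∣e (proj₂ (E-divisor e∈)))) λ j pⱼ∣e' →
            let j≢s , aⱼ≢0 = label≡1⇒ a s j (label-of pⱼ∣e' ℓⱼ₁≡1)
            in drop-keeps a s j j≢s (n≢0⇒n>0 aⱼ≢0))
        by-colour 2 ℓⱼ₁≡2 _ with members-share e∈ e'∈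
        ... | j , pⱼ∣e , pⱼ∣e' = ⊥-elim (<-irrefl (sym (label≡2⇒ a s j (label-of pⱼ∣e' ℓⱼ₁≡2)))
          (prime∣⟦⟧⇒1≤ a j (subst (p j ∣_) e≡⟦a⟧ pⱼ∣e)))
        by-colour (suc (suc (suc _))) _ (s≤s (s≤s ()))

    prime-member : Σ (Fin n) λ w → p w ∈ D
    prime-member = prime-member-below _ (<-wellFounded _) (ψ-into pᵤ∈R)

    -- A prime member p_w has minimal exponent.  Otherwise p_w = ψ d for an outsider
    -- d = ⟦ x ⟧ of R({p_u}, N) with x_w − t ≡ 1; since t ≤ α_u < α_w this forces
    -- x_w = t + 1 ≥ 1, so p_w ∣ d and d ∈ R({p_w}, N) = D after all.
    prime-member-minimal : ∀ w → p w ∈ D → ¬ α u < α w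
    prime-member-minimal w p_w∈ αᵤ<α_w with ψ-onto p_w∈
    ... | d , d∈R , ψd≡p_w with ψ-cases d
    ...   | inj₁ (_ , ψd≡d) = <-irrefl (cong α u≡w) αᵤ<α_w
      where
      u≡w : u ≡ w
      u≡w = distinct u w (prime∣prime⇒≡ (prime u) (prime w)
        (subst (p u ∣_) (trans (sym ψd≡d) ψd≡p_w) (proj₂ d∈R)))
    ...   | inj₂ (d∉ , ψd≡) = d∉ (proj₂ (prime-member⇒R w p_w∈ d) (proj₁ d∈R , p_w∣d))
      where
      shift-w≡1 : shift (x d∈R) w ≡ 1
      shift-w≡1 = trans (pp-injective n p (shift (x d∈R)) (unit w) prime distinct
        (trans (sym ψd≡) (trans ψd≡p_w (sym (pp-unit n p w)))) w) (updateAt-updates w (λ _ → 0))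
      t<α_w : t d∈R < α w
      t<α_w = ≤-<-trans (x≤α d∈R u) αᵤ<α_w
      x_w≡1+t : x d∈R w ≡ suc (t d∈R)
      x_w≡1+t = subMod-injˡ _ _ (t d∈R) (α w) (t≤α d∈R w) (x≤α d∈R w) t<α_w
        (trans shift-w≡1 (sym (subMod-suc (t d∈R) (α w))))
      p_w∣d : p w ∣ d
      p_w∣d = subst (p w ∣_) (sym (d≡⟦x⟧ d∈R)) (pp-dvd n p (x d∈R) w (subst (1 ≤_) (sym x_w≡1+t) (s≤s z≤n)))

exponent-at-u-minimal : ∀ {n} (α : Fin n → ℕ) u (u<n : u < n) →
  (∀ i → toℕ i < u → α (fromℕ< u<n) < α i) → (∀ i → u ≤ toℕ i → α i ≡ α (fromℕ< u<n)) →
  ∀ i → α (fromℕ< u<n) ≤ α i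
exponent-at-u-minimal α u u<n before-u from-u i with toℕ i <? u
... | yes i<u = <⇒≤ (before-u i i<u)
... | no  i≮u = ≤-reflexive (sym (from-u i (≮⇒≥ i≮u)))

theorem4 : (n : ℕ) (p : Fin n → ℕ) (α : Fin n → ℕ) (u : ℕ) (u<n : u < n) →
    (∀ i → Prime (p i)) →
    (∀ i j → p i ≡ p j → i ≡ j) →
    (∀ i j → i ≤ᶠ j → α j ≤ α i) →
    (∀ i → toℕ i < u → α (fromℕ< u<n) < α i) →
    (∀ i → u ≤ toℕ i → α i ≡ α (fromℕ< u<n)) →
    2 ≤ α (fromℕ< u<n) →
    (D : List ℕ) → DivisorSet (primePowerProduct n p α) D →
    IsMinMaximalNSet (primePowerProduct n p α) D ⇔
      (∃[ v ] (u ≤ toℕ v × EqualsR (primePowerProduct n p α) (p v) D))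
theorem4 n p α u u<n prime distinct _ before-u from-u 2≤αᵤ D D-div = mk⇔ forward backward
  where
  open DivisorsOf n p α prime distinct

  u-min : ∀ i → α (fromℕ< u<n) ≤ α i
  u-min = exponent-at-u-minimal α u u<n before-u from-u

  forward : IsMinMaximalNSet N D → ∃[ v ] (u ≤ toℕ v × EqualsR N (p v) D)
  forward D-min = conclude prime-member
    where
    open MinimumSize (fromℕ< u<n) u-min 2≤αᵤ D D-min
    conclude : Σ (Fin n) (λ w → p w ∈ D) → ∃[ v ] (u ≤ toℕ v × EqualsR N (p v) D)
    conclude (w , p_w∈D) = w , ≮⇒≥ (λ w<u → prime-member-minimal w p_w∈D (before-u w w<u)) ,
      Maximal.prime-member⇒R D (proj₁ D-min) w p_w∈D

  backward : ∃[ v ] (u ≤ toℕ v × EqualsR N (p v) D) → IsMinMaximalNSet N D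
  backward (v , u≤v , D≡R) =
    R-maximal v D (≤-trans (s≤s z≤n) (≤-trans 2≤αᵤ (u-min v))) D≡R D-div ,
    λ E E-max → R-minimum v v-min D E D≡R D-div E-max
    where
    v-min : ∀ i → α v ≤ α i
    v-min i = subst (_≤ α i) (sym (from-u v u≤v)) (u-min i)
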